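{- Suppose that $F$ is an $r$-graph and $P$ is a minimal pattern such that $(F,P)$ is a Turán pair. Then $\mathrm{ex}(n,F)$ is $4\binom{n-1}{r-2}$-smooth, that is, \[ \left|\delta(n,F) - d(n-1,F)\right| \le 4\binom{n-1}{r-2} \] for every integer $n\ge 2$.
   Context: An $r$-graph is a collection of $r$-subsets (edges) of a finite vertex set. $\mathrm{ex}(n,F)$ is the maximum number of edges of an $n$-vertex $r$-graph not containing $F$; $d(n,F):=r\cdot\mathrm{ex}(n,F)/n$ and $\delta(n,F):=\mathrm{ex}(n,F)-\mathrm{ex}(n-1,F)$. An $r$-multiset is an unordered collection of $r$ elements with repetitions allowed. A pattern is a pair $P=(k,E)$ with $k$ a positive integer and $E$ a collection of $r$-multisets on $[k]$. Given disjoint sets $V_1,\dots,V_k$, the profile of an $r$-set $X\subseteq V_1\cup\dots\cup V_k$ is the $r$-multiset on $[k]$ containing $i$ with multiplicity $|X\cap V_i|$; an $r$-graph $\mathcal{G}$ is a $P$-construction on $V$ if there is a partition $V=V_1\cup\dots\cup V_k$ such that $\mathcal{G}$ consists exactly of all $r$-subsets of $V$ whose profile lies in $E$. A $P$-subconstruction is a subgraph of a $P$-construction. $\Lambda(P,n)$ is the maximum number of edges of an $n$-vertex $P$-construction and $\lambda(P)=\lim_{n\to\infty}\Lambda(P,n)/\binom{n}{r}$. For $i\in[k]$, $P-i$ is the pattern obtained by removing $i$ from $[k]$ and all multisets containing $i$ from $E$. $P$ is minimal if $\lambda(P-i)<\lambda(P)$ for all $i\in[k]$. $(F,P)$ is a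 Turán pair if every $P$-construction is $F$-free and every $F$-free $r$-graph with $\mathrm{ex}(n,F)$ edges on $n$ vertices (for every $n$) is a $P$-construction. -}

module Defs where

open import Data.Nat using (ℕ; zero; suc; _+_; _*_; _∸_; _≤_; _<_)
import Data.Nat as ℕ
open import Data.Nat.Combinatorics using (_C_)
open import Data.Bool using (Bool; true; false; _∧_)
open import Data.Fin using (Fin; zero; suc)
import Data.Fin.Properties as FinP
open import Data.Fin.Subset using (Subset; ∣_∣; _∩_)
open import Data.Fin.Subset.Properties using (_∈?_)
open import Data.Vec using (Vec; tabulate; lookup; removeAt)
open import Data.List using (List; length; map; filter)
open import Data.List.Relation.Unary.Unique.Propositional using (Unique)
open import Data.List.Relation.Unary.All using (All)
import Data.List.Membership.Propositional as LM
open import Data.Product using (Σ; ∃; _×_; _,_)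
open import Function using (_∘_; _⇔_)
open import Function.Definitions using (Injective)
open import Relation.Nullary using (does; _×-dec_)
open import Relation.Binary.PropositionalEquality using (_≡_)

record RGraph (r n : ℕ) : Set where
  constructor mkRGraph
  field
    edges   : List (Subset n)
    unique  : Unique edges
    uniform : All (λ e → ∣ e ∣ ≡ r) edges
open RGraph public

size : ∀ {r n} → RGraph r n → ℕ
size G = length (edges G)

image : ∀ {m n} → (Fin m → Fin n) → Subset m → Subset n
image φ e = tabulate (λ j → does (FinP.any? (λ i → (i ∈? e) ×-dec (φ i FinP.≟ j))))

Contains : ∀ {r m n} → RGraph r m → RGraph r n → Set
Contains {m = m} {n = n} F G =
  Σ (Fin m → Fin n) λ φ → Injective _≡_ _≡_ φ × All (λ e → image φ e LM.∈ edges G) (edges F)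

FFree : ∀ {r m n} → RGraph r m → RGraph r n → Set
FFree F G = Contains F G → Data.Empty.⊥
  where import Data.Empty

IsEx : ∀ {r m} → RGraph r m → ℕ → ℕ → Set
IsEx {r} F n a =
  (Σ (RGraph r n) λ G → FFree F G × size G ≡ a)
  × (∀ (G : RGraph r n) → FFree F G → size G ≤ a)

-- Patterns: k parts, and a collection E of multisets on [k], each
-- multiset represented by its multiplicity vector in Vec ℕ k.
record Pattern : Set where
  constructor mkPattern
  field
    k : ℕ
    E : List (Vec ℕ k)
open Pattern public

IsRPattern : ℕ → Pattern → Set
IsRPattern r P = (1 ≤ k P) × All (λ v → Data.Vec.sum v ≡ r) (E P)
  where import Data.Vec

_─_ : (P : Pattern) → Fin (k P) → Pattern
mkPattern (suc k') E' ─ i =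
  mkPattern k' (map (λ v → removeAt v i) (filter (λ v → lookup v i ℕ.≟ 0) E'))

profile : ∀ {n k} → (Fin n → Fin k) → Subset n → Vec ℕ k
profile part X = tabulate (λ i → ∣ X ∩ tabulate (λ j → does (part j FinP.≟ i)) ∣)

IsConstruction : ∀ {r n} → Pattern → RGraph r n → Set
IsConstruction {r} {n} P G =
  Σ (Fin n → Fin (k P)) λ part →
    ∀ (X : Subset n) → (X LM.∈ edges G) ⇔ (∣ X ∣ ≡ r × profile part X LM.∈ E P)

IsΛ : ℕ → Pattern → ℕ → ℕ → Set
IsΛ r P n a =
  (Σ (RGraph r n) λ G → IsConstruction P G × size G ≡ a)
  × (∀ (G : RGraph r n) → IsConstruction P G → size G ≤ a)

-- λ(Q) < λ(P) (for r-graphs), where λ(P) = lim Λ(P,n)/C(n,r):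
-- there is a rational ε = a/b > 0 and N with
-- Λ(Q,n)/C(n,r) + ε ≤ Λ(P,n)/C(n,r) for all n ≥ N.
LambdaLt : ℕ → Pattern → Pattern → Set
LambdaLt r Q P =
  Σ ℕ λ a → Σ ℕ λ b → Σ ℕ λ N → (1 ≤ a) × (1 ≤ b) ×
    (∀ n (q p : ℕ) → N ≤ n → IsΛ r Q n q → IsΛ r P n p → b * q + a * (n C r) ≤ b * p)

Minimal : ℕ → Pattern → Set
Minimal r P = ∀ (i : Fin (k P)) → LambdaLt r (P ─ i) P

TuranPair : ∀ {r m} → RGraph r m → Pattern → Set
TuranPair {r} F P =
  (∀ n (G : RGraph r n) → IsConstruction P G → FFree F G)
  × (∀ n (G : RGraph r n) → FFree F G → (∀ (H : RGraph r n) → FFree F H → size H ≤ size G)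
       → IsConstruction P G)

-- binomial coefficient C(n, r-2), with the convention C(n,j)=0 for j<0
binomMinus2 : ℕ → ℕ → ℕ
binomMinus2 n zero = 0
binomMinus2 n (suc zero) = 0
binomMinus2 n (suc (suc s)) = n C s

-- Let a = ex(n,F) and b = ex(n-1,F). Deleting a vertex v from an extremal n-vertex graph G
-- leaves an F-free graph, so a ≤ b + deg v; summing over v with ∑ deg = r a gives
-- n a ≤ n b + r a. An extremal (n-1)-vertex graph G′ is a P-construction, and cloning a
-- vertex u of G′ (adding a twin in the part of u) gives an n-vertex P-construction, hence an
-- F-free graph, with at least b + deg u edges; summing gives (n-1) b + r b ≤ (n-1) a. With
-- x = a - b these say 0 ≤ (n-1) x - r b ≤ (r-1) x, and x ≤ deg v ≤ C(n-1,r-1), while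
-- (r-1) C(n-1,r-1) ≤ (n-1) C(n-1,r-2). So the bound holds with constant 1 instead of 4.
module Submission where

open import Defs
open import Data.Bool using (Bool; true; false; _∧_)
import Data.Bool as Bool
open import Data.Empty using (⊥)
open import Data.Fin using (Fin; zero; suc; punchIn; punchOut)
import Data.Fin.Properties as Fin
open import Data.Fin.Subset using (Subset; inside; outside; _∩_)
import Data.Fin.Subset as Subset
open import Data.Fin.Subset.Properties using (_∈?_)
open import Data.Integer using (+_; _-_; ∣_∣)
import Data.Integer as ℤ
import Data.Integer.Properties as ℤP
open import Data.List using (List; []; _∷_; _++_; length; map; filter)
import Data.List.Membership.DecPropositional as DecMembership
open import Data.List.Membership.Propositional using (_∈_)
open import Data.List.Membership.Propositional.Properties
  using (∈-∃++; ∈-++⁻; ∈-++⁺ˡ; ∈-++⁺ʳ; ∈-map⁺; ∈-map⁻; ∈-filter⁺; ∈-filter⁻; ∈-map∘filter⁻)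
open import Data.List.Properties using (length-map; length-++; length-++-sucʳ)
open import Data.List.Relation.Binary.Subset.Propositional using (_⊆_)
open import Data.List.Relation.Unary.All using (All; []; _∷_)
import Data.List.Relation.Unary.All as All
import Data.List.Relation.Unary.All.Properties as All
open import Data.List.Relation.Unary.AllPairs using ([]; _∷_)
open import Data.List.Relation.Unary.Any using (here; there)
open import Data.List.Relation.Unary.Unique.Propositional using (Unique)
import Data.List.Relation.Unary.Unique.Propositional.Properties as Unique
open import Data.Nat using (ℕ; zero; suc; pred; _+_; _*_; _∸_; _≤_; z≤n; s≤s; NonZero)
import Data.Nat as ℕ
open import Data.Nat.Combinatorics using (_C_; nC1≡n; nCk+nC[k+1]≡[n+1]C[k+1])
open import Data.Nat.Properties
open import Algebra.Properties.CommutativeMonoid.Sum +-0-commutativeMonoid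
  using (sum; sum-syntax; sum-cong-≗; ∑-distrib-+)
open import Algebra.Properties.CommutativeSemigroup +-commutativeSemigroup using (x∙yz≈y∙xz)
open import Data.Nat.Tactic.RingSolver using (solve-∀)
open import Data.Product using (∃; _×_; _,_; proj₁; proj₂)
open import Data.Sum using (inj₁; inj₂)
open import Data.Vec using ([]; _∷_; lookup; insertAt; removeAt; _[_]≔_; tabulate)
open import Data.Vec.Properties
  using ( ∷-injectiveʳ; ≡-dec; []≔-idempotent; []≔-lookup; insertAt-removeAt; insertAt-lookup
        ; insertAt-punchIn; lookup∘tabulate; lookup-zipWith; tabulate-cong; tabulate∘lookup)
open import Function using (_∘_; mk⇔; Equivalence)
open import Relation.Binary.PropositionalEquality
open import Relation.Nullary using (Dec; yes; no; does; contradiction; _×-dec_)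
open import Relation.Nullary.Decidable using (dec-false; does-⇔)
open import Relation.Unary using (Decidable)

private variable
  A B : Set
  r m n : ℕ

iverson : Bool → ℕ
iverson true  = 1
iverson false = 0

∑-const : ∀ n c → ∑[ i < n ] c ≡ n * c
∑-const zero    c = refl
∑-const (suc n) c = cong (_+_ c) (∑-const n c)

∑-mono-≤ : {f g : Fin n → ℕ} → (∀ i → f i ≤ g i) → sum f ≤ sum g
∑-mono-≤ {zero}  f≤g = z≤n
∑-mono-≤ {suc n} f≤g = +-mono-≤ (f≤g zero) (∑-mono-≤ (f≤g ∘ suc))

[k+1]*nC[k+1]+k*nCk≡n*nCk : ∀ n k → suc k * (n C suc k) + k * (n C k) ≡ n * (n C k)
[k+1]*nC[k+1]+k*nCk≡n*nCk zero    zero    = refl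
[k+1]*nC[k+1]+k*nCk≡n*nCk zero    (suc k) = cong₂ _+_ (*-zeroʳ (suc (suc k))) (*-zeroʳ (suc k))
[k+1]*nC[k+1]+k*nCk≡n*nCk (suc n) zero    = begin
  suc n C 1 + 0 + 0 ≡⟨ cong (λ c → c + 0 + 0) (nC1≡n (suc n)) ⟩
  suc n + 0 + 0     ≡⟨ trans (+-identityʳ _) (+-identityʳ _) ⟩
  suc n             ≡⟨ *-identityʳ (suc n) ⟨
  suc n * 1         ∎
  where open ≡-Reasoning
[k+1]*nC[k+1]+k*nCk≡n*nCk (suc n) (suc k) = begin
  suc (suc k) * (suc n C suc (suc k)) + suc k * (suc n C suc k)
    ≡⟨ cong₂ (λ c d → suc (suc k) * c + suc k * d) (sym (pascal (suc k))) (sym (pascal k)) ⟩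
  suc (suc k) * (c₁ + c₂) + suc k * (c₀ + c₁)
    ≡⟨ regroup k c₀ c₁ c₂ ⟩
  (suc (suc k) * c₂ + suc k * c₁) + c₁ + ((suc k * c₁ + k * c₀) + c₀)
    ≡⟨ cong₂ (λ c d → c + c₁ + (d + c₀)) ([k+1]*nC[k+1]+k*nCk≡n*nCk n (suc k)) ([k+1]*nC[k+1]+k*nCk≡n*nCk n k) ⟩
  n * c₁ + c₁ + (n * c₀ + c₀)
    ≡⟨ collect n c₀ c₁ ⟩
  suc n * (c₀ + c₁)
    ≡⟨ cong (suc n *_) (pascal k) ⟩
  suc n * (suc n C suc k) ∎
  where
  open ≡-Reasoning
  pascal : ∀ j → n C j + n C suc j ≡ suc n C suc j
  pascal = nCk+nC[k+1]≡[n+1]C[k+1] n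
  c₀ c₁ c₂ : ℕ
  c₀ = n C k
  c₁ = n C suc k
  c₂ = n C suc (suc k)
  regroup : ∀ k c₀ c₁ c₂ → suc (suc k) * (c₁ + c₂) + suc k * (c₀ + c₁)
                         ≡ (suc (suc k) * c₂ + suc k * c₁) + c₁ + ((suc k * c₁ + k * c₀) + c₀)
  regroup = solve-∀
  collect : ∀ n c₀ c₁ → n * c₁ + c₁ + (n * c₀ + c₀) ≡ suc n * (c₀ + c₁)
  collect = solve-∀

pred[r]*nC[pred[r]]≤n*binomMinus2 : ∀ n r → pred r * (n C pred r) ≤ n * binomMinus2 n r
pred[r]*nC[pred[r]]≤n*binomMinus2 n zero          = z≤n
pred[r]*nC[pred[r]]≤n*binomMinus2 n (suc zero)    = z≤n
pred[r]*nC[pred[r]]≤n*binomMinus2 n (suc (suc k)) =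
  ≤-trans (m≤m+n _ _) (≤-reflexive ([k+1]*nC[k+1]+k*nCk≡n*nCk n k))

unique-⊆⇒length≤ : {xs ys : List A} → Unique xs → xs ⊆ ys → length xs ≤ length ys
unique-⊆⇒length≤ {xs = []}     _            _   = z≤n
unique-⊆⇒length≤ {xs = x ∷ xs} (x∉xs ∷ !xs) sub with ys₁ , ys₂ , refl ← ∈-∃++ (sub (here refl)) =
  ≤-trans (s≤s (unique-⊆⇒length≤ !xs skip-x)) (≤-reflexive (sym (length-++-sucʳ ys₁ x ys₂)))
  where
  skip-x : xs ⊆ ys₁ ++ ys₂
  skip-x {y} y∈xs with ∈-++⁻ ys₁ (sub (there y∈xs))
  ... | inj₁ y∈ys₁         = ∈-++⁺ˡ y∈ys₁
  ... | inj₂ (here refl)   = contradiction refl (All.lookup x∉xs y∈xs)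
  ... | inj₂ (there y∈ys₂) = ∈-++⁺ʳ ys₁ y∈ys₂

Unique-map⁺ : {f : A → B} {xs : List A} →
  (∀ {x y} → x ∈ xs → y ∈ xs → f x ≡ f y → x ≡ y) → Unique xs → Unique (map f xs)
Unique-map⁺ inj [] = []
Unique-map⁺ inj (x∉xs ∷ !xs) =
  All.map⁺ (All.tabulate λ y∈xs fx≡fy → All.lookup x∉xs y∈xs (inj (here refl) (there y∈xs) fx≡fy))
  ∷ Unique-map⁺ (λ x∈ y∈ → inj (there x∈) (there y∈)) !xs

∣b∷p∣≡iverson[b]+∣p∣ : ∀ b (p : Subset n) → Subset.∣ b ∷ p ∣ ≡ iverson b + Subset.∣ p ∣
∣b∷p∣≡iverson[b]+∣p∣ inside  p = refl
∣b∷p∣≡iverson[b]+∣p∣ outside p = refl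

∑-iverson≡∣p∣ : (p : Subset n) → ∑[ i < n ] iverson (lookup p i) ≡ Subset.∣ p ∣
∑-iverson≡∣p∣ []      = refl
∑-iverson≡∣p∣ (b ∷ p) = trans (cong (_+_ (iverson b)) (∑-iverson≡∣p∣ p)) (sym (∣b∷p∣≡iverson[b]+∣p∣ b p))

∣insertAt∣ : (p : Subset n) → ∀ i b → Subset.∣ insertAt p i b ∣ ≡ iverson b + Subset.∣ p ∣
∣insertAt∣ p       zero    b = ∣b∷p∣≡iverson[b]+∣p∣ b p
∣insertAt∣ (c ∷ p) (suc i) b = begin
  Subset.∣ c ∷ insertAt p i b ∣      ≡⟨ ∣b∷p∣≡iverson[b]+∣p∣ c (insertAt p i b) ⟩
  iverson c + Subset.∣ insertAt p i b ∣ ≡⟨ cong (_+_ (iverson c)) (∣insertAt∣ p i b) ⟩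
  iverson c + (iverson b + Subset.∣ p ∣) ≡⟨ x∙yz≈y∙xz (iverson c) (iverson b) (Subset.∣ p ∣) ⟩
  iverson b + (iverson c + Subset.∣ p ∣) ≡⟨ cong (_+_ (iverson b)) (∣b∷p∣≡iverson[b]+∣p∣ c p) ⟨
  iverson b + Subset.∣ c ∷ p ∣          ∎
  where open ≡-Reasoning

∣p∣≡iverson+∣removeAt∣ : (p : Subset (suc n)) → ∀ i → Subset.∣ p ∣ ≡ iverson (lookup p i) + Subset.∣ removeAt p i ∣
∣p∣≡iverson+∣removeAt∣ p i =
  trans (cong Subset.∣_∣ (sym (insertAt-removeAt p i))) (∣insertAt∣ (removeAt p i) i (lookup p i))

∣p∣≡iverson+∣p[i]≔outside∣ : (p : Subset n) → ∀ i → Subset.∣ p ∣ ≡ iverson (lookup p i) + Subset.∣ p [ i ]≔ outside ∣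
∣p∣≡iverson+∣p[i]≔outside∣ (b ∷ p) zero    = ∣b∷p∣≡iverson[b]+∣p∣ b p
∣p∣≡iverson+∣p[i]≔outside∣ (b ∷ p) (suc i) = begin
  Subset.∣ b ∷ p ∣                                  ≡⟨ ∣b∷p∣≡iverson[b]+∣p∣ b p ⟩
  iverson b + Subset.∣ p ∣                          ≡⟨ cong (_+_ (iverson b)) (∣p∣≡iverson+∣p[i]≔outside∣ p i) ⟩
  iverson b + (iverson (lookup p i) + Subset.∣ p′ ∣) ≡⟨ x∙yz≈y∙xz (iverson b) (iverson (lookup p i)) (Subset.∣ p′ ∣) ⟩
  iverson (lookup p i) + (iverson b + Subset.∣ p′ ∣) ≡⟨ cong (_+_ (iverson (lookup p i))) (∣b∷p∣≡iverson[b]+∣p∣ b p′) ⟨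
  iverson (lookup p i) + Subset.∣ b ∷ p′ ∣          ∎
  where
  open ≡-Reasoning
  p′ = p [ i ]≔ outside

∣inside∷p[i]≔outside∣≡∣p∣ : (p : Subset n) → ∀ i → lookup p i ≡ inside →
  Subset.∣ inside ∷ p [ i ]≔ outside ∣ ≡ Subset.∣ p ∣
∣inside∷p[i]≔outside∣≡∣p∣ p i i∈p =
  sym (trans (∣p∣≡iverson+∣p[i]≔outside∣ p i) (cong (λ b → iverson b + Subset.∣ p [ i ]≔ outside ∣) i∈p))

[]≔outside-∩ : (p q : Subset n) → ∀ i → (p ∩ q) [ i ]≔ outside ≡ (p [ i ]≔ outside) ∩ q
[]≔outside-∩ (b ∷ p) (c ∷ q) zero    = refl
[]≔outside-∩ (b ∷ p) (c ∷ q) (suc i) = cong ((b ∧ c) ∷_) ([]≔outside-∩ p q i)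

∣p∩q∣≡iverson[q[i]]+∣p[i]≔outside∩q∣ : (p q : Subset n) → ∀ i → lookup p i ≡ inside →
  Subset.∣ p ∩ q ∣ ≡ iverson (lookup q i) + Subset.∣ (p [ i ]≔ outside) ∩ q ∣
∣p∩q∣≡iverson[q[i]]+∣p[i]≔outside∩q∣ p q i i∈p = begin
  Subset.∣ p ∩ q ∣                                                  ≡⟨ ∣p∣≡iverson+∣p[i]≔outside∣ (p ∩ q) i ⟩
  iverson (lookup (p ∩ q) i) + Subset.∣ (p ∩ q) [ i ]≔ outside ∣    ≡⟨ cong₂ (λ b s → iverson b + Subset.∣ s ∣) q[i] ([]≔outside-∩ p q i) ⟩
  iverson (lookup q i) + Subset.∣ (p [ i ]≔ outside) ∩ q ∣         ∎
  where
  open ≡-Reasoning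
  q[i] : lookup (p ∩ q) i ≡ lookup q i
  q[i] = trans (lookup-zipWith _∧_ i p q) (cong (_∧ lookup q i) i∈p)

removeAt-injectiveOn : (p q : Subset (suc n)) → ∀ i →
  lookup p i ≡ lookup q i → removeAt p i ≡ removeAt q i → p ≡ q
removeAt-injectiveOn p q i p[i]≡q[i] eq = begin
  p                                   ≡⟨ insertAt-removeAt p i ⟨
  insertAt (removeAt p i) i (lookup p i) ≡⟨ cong₂ (λ s b → insertAt s i b) eq p[i]≡q[i] ⟩
  insertAt (removeAt q i) i (lookup q i) ≡⟨ insertAt-removeAt q i ⟩
  q                                   ∎
  where open ≡-Reasoning

[]≔outside-injectiveOn : (p q : Subset n) → ∀ i → lookup p i ≡ inside → lookup q i ≡ inside →
  p [ i ]≔ outside ≡ q [ i ]≔ outside → p ≡ q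
[]≔outside-injectiveOn p q i i∈p i∈q eq = begin
  p                              ≡⟨ []≔-lookup p i ⟨
  p [ i ]≔ lookup p i            ≡⟨ cong (p [ i ]≔_) i∈p ⟩
  p [ i ]≔ inside                ≡⟨ []≔-idempotent p i ⟨
  (p [ i ]≔ outside) [ i ]≔ inside ≡⟨ cong (_[ i ]≔ inside) eq ⟩
  (q [ i ]≔ outside) [ i ]≔ inside ≡⟨ []≔-idempotent q i ⟩
  q [ i ]≔ inside                ≡⟨ cong (q [ i ]≔_) i∈q ⟨
  q [ i ]≔ lookup q i            ≡⟨ []≔-lookup q i ⟩
  q                              ∎
  where open ≡-Reasoning

subsetsOfSize : ∀ n → ℕ → List (Subset n)
subsetsOfSize zero    zero    = [] ∷ []
subsetsOfSize zero    (suc s) = []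
subsetsOfSize (suc n) zero    = map (outside ∷_) (subsetsOfSize n zero)
subsetsOfSize (suc n) (suc s) = map (outside ∷_) (subsetsOfSize n (suc s)) ++ map (inside ∷_) (subsetsOfSize n s)

length-subsetsOfSize : ∀ n s → length (subsetsOfSize n s) ≡ n C s
length-subsetsOfSize zero    zero    = refl
length-subsetsOfSize zero    (suc s) = refl
length-subsetsOfSize (suc n) zero    = trans (length-map _ (subsetsOfSize n zero)) (length-subsetsOfSize n zero)
length-subsetsOfSize (suc n) (suc s) = begin
  length (map (outside ∷_) (subsetsOfSize n (suc s)) ++ map (inside ∷_) (subsetsOfSize n s))
    ≡⟨ length-++ (map (outside ∷_) (subsetsOfSize n (suc s))) ⟩
  length (map (outside ∷_) (subsetsOfSize n (suc s))) + length (map (inside ∷_) (subsetsOfSize n s))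
    ≡⟨ cong₂ _+_ (length-map _ (subsetsOfSize n (suc s))) (length-map _ (subsetsOfSize n s)) ⟩
  length (subsetsOfSize n (suc s)) + length (subsetsOfSize n s)
    ≡⟨ cong₂ _+_ (length-subsetsOfSize n (suc s)) (length-subsetsOfSize n s) ⟩
  n C suc s + n C s
    ≡⟨ +-comm (n C suc s) (n C s) ⟩
  n C s + n C suc s
    ≡⟨ nCk+nC[k+1]≡[n+1]C[k+1] n s ⟩
  suc n C suc s ∎
  where open ≡-Reasoning

∈-subsetsOfSize⁺ : ∀ {s} (p : Subset n) → Subset.∣ p ∣ ≡ s → p ∈ subsetsOfSize n s
∈-subsetsOfSize⁺ {s = zero}  []            refl = here refl
∈-subsetsOfSize⁺ {s = zero}  (outside ∷ p) ∣p∣≡0 = ∈-map⁺ (outside ∷_) (∈-subsetsOfSize⁺ p ∣p∣≡0)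
∈-subsetsOfSize⁺ {s = suc s} (outside ∷ p) ∣p∣≡s = ∈-++⁺ˡ (∈-map⁺ (outside ∷_) (∈-subsetsOfSize⁺ p ∣p∣≡s))
∈-subsetsOfSize⁺ {n = suc n} {s = suc s} (inside ∷ p) ∣p∣≡s =
  ∈-++⁺ʳ (map (outside ∷_) (subsetsOfSize n (suc s))) (∈-map⁺ (inside ∷_) (∈-subsetsOfSize⁺ p (suc-injective ∣p∣≡s)))

∈-subsetsOfSize⁻ : ∀ {s} {p : Subset n} → p ∈ subsetsOfSize n s → Subset.∣ p ∣ ≡ s
∈-subsetsOfSize⁻ {zero}  {zero} (here refl) = refl
∈-subsetsOfSize⁻ {suc n} {zero} p∈ with _ , q∈ , refl ← ∈-map⁻ (outside ∷_) p∈ = ∈-subsetsOfSize⁻ q∈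
∈-subsetsOfSize⁻ {suc n} {suc s} p∈ with ∈-++⁻ (map (outside ∷_) (subsetsOfSize n (suc s))) p∈
... | inj₁ p∈₁ with _ , q∈ , refl ← ∈-map⁻ (outside ∷_) p∈₁ = ∈-subsetsOfSize⁻ q∈
... | inj₂ p∈₂ with _ , q∈ , refl ← ∈-map⁻ (inside ∷_) p∈₂ = cong suc (∈-subsetsOfSize⁻ q∈)

subsetsOfSize-unique : ∀ n s → Unique (subsetsOfSize n s)
subsetsOfSize-unique zero    zero    = [] ∷ []
subsetsOfSize-unique zero    (suc s) = []
subsetsOfSize-unique (suc n) zero    = Unique.map⁺ ∷-injectiveʳ (subsetsOfSize-unique n zero)
subsetsOfSize-unique (suc n) (suc s) =
  Unique.++⁺ (Unique.map⁺ ∷-injectiveʳ (subsetsOfSize-unique n (suc s)))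
             (Unique.map⁺ ∷-injectiveʳ (subsetsOfSize-unique n s))
             heads-differ
  where
  heads-differ : ∀ {p} → p ∈ map (outside ∷_) (subsetsOfSize n (suc s)) × p ∈ map (inside ∷_) (subsetsOfSize n s) → ⊥
  heads-differ (p∈₁ , p∈₂) with ∈-map⁻ (outside ∷_) p∈₁ | ∈-map⁻ (inside ∷_) p∈₂
  ... | _ , _ , refl | _ , _ , ()

size≤nCr : (G : RGraph r n) → size G ≤ n C r
size≤nCr {r} {n} G = begin
  size G                     ≤⟨ unique-⊆⇒length≤ (unique G) (λ X∈ → ∈-subsetsOfSize⁺ _ (All.lookup (uniform G) X∈)) ⟩
  length (subsetsOfSize n r) ≡⟨ length-subsetsOfSize n r ⟩
  n C r                      ∎
  where open ≤-Reasoning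

edgesWith : Fin n → Bool → List (Subset n) → List (Subset n)
edgesWith v b = filter (λ X → lookup X v Bool.≟ b)

deg : Fin n → RGraph r n → ℕ
deg v G = length (edgesWith v inside (edges G))

length-edgesWith-∷ : ∀ v (X : Subset n) L →
  length (edgesWith v inside (X ∷ L)) ≡ iverson (lookup X v) + length (edgesWith v inside L)
length-edgesWith-∷ v X L with lookup X v
... | inside  = refl
... | outside = refl

length-edgesWith-inside+outside : ∀ v (L : List (Subset n)) →
  length (edgesWith v inside L) + length (edgesWith v outside L) ≡ length L
length-edgesWith-inside+outside v []      = refl
length-edgesWith-inside+outside v (X ∷ L) with lookup X v
... | inside  = cong suc (length-edgesWith-inside+outside v L)
... | outside = trans (+-suc _ _) (cong suc (length-edgesWith-inside+outside v L))

∑-length-edgesWith : (L : List (Subset n)) → All (λ X → Subset.∣ X ∣ ≡ r) L →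
  ∑[ v < n ] length (edgesWith v inside L) ≡ r * length L
∑-length-edgesWith {n} {r} []      []             = trans (∑-const n 0) (trans (*-zeroʳ n) (sym (*-zeroʳ r)))
∑-length-edgesWith {n} {r} (X ∷ L) (∣X∣≡r ∷ ∣L∣≡r) = begin
  ∑[ v < n ] length (edgesWith v inside (X ∷ L))
    ≡⟨ sum-cong-≗ (λ v → length-edgesWith-∷ v X L) ⟩
  ∑[ v < n ] (iverson (lookup X v) + length (edgesWith v inside L))
    ≡⟨ ∑-distrib-+ (iverson ∘ lookup X) (λ v → length (edgesWith v inside L)) ⟩
  ∑[ v < n ] iverson (lookup X v) + ∑[ v < n ] length (edgesWith v inside L)
    ≡⟨ cong₂ _+_ (trans (∑-iverson≡∣p∣ X) ∣X∣≡r) (∑-length-edgesWith L ∣L∣≡r) ⟩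
  r + r * length L
    ≡⟨ *-suc r (length L) ⟨
  r * suc (length L) ∎
  where open ≡-Reasoning

∑[d+deg]≡n*d+r*size : ∀ d (G : RGraph r n) → ∑[ v < n ] (d + deg v G) ≡ n * d + r * size G
∑[d+deg]≡n*d+r*size {n = n} d G =
  trans (∑-distrib-+ (λ _ → d) (λ v → deg v G))
        (cong₂ _+_ (∑-const n d) (∑-length-edgesWith (edges G) (uniform G)))

slice : (G : RGraph r (suc n)) → Fin (suc n) → ∀ b → RGraph (r ∸ iverson b) n
slice {r} {n} G v b = mkRGraph (map (λ X → removeAt X v) (edgesWith v b (edges G))) unique′ uniform′
  where
  coordinate : ∀ {X} → X ∈ edgesWith v b (edges G) → X ∈ edges G × lookup X v ≡ b
  coordinate = ∈-filter⁻ (λ X → lookup X v Bool.≟ b)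
  unique′ : Unique (map (λ X → removeAt X v) (edgesWith v b (edges G)))
  unique′ = Unique-map⁺
    (λ X∈ Y∈ → removeAt-injectiveOn _ _ v (trans (proj₂ (coordinate X∈)) (sym (proj₂ (coordinate Y∈)))))
    (Unique.filter⁺ _ (unique G))
  size-removeAt : ∀ {X} → X ∈ edgesWith v b (edges G) → Subset.∣ removeAt X v ∣ ≡ r ∸ iverson b
  size-removeAt {X} X∈ with X∈G , refl ← coordinate X∈ = begin
    Subset.∣ removeAt X v ∣                                ≡⟨ m+n∸m≡n (iverson (lookup X v)) _ ⟨
    iverson (lookup X v) + Subset.∣ removeAt X v ∣ ∸ iverson (lookup X v)
                                                          ≡⟨ cong (_∸ iverson (lookup X v)) (∣p∣≡iverson+∣removeAt∣ X v) ⟨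
    Subset.∣ X ∣ ∸ iverson (lookup X v)                    ≡⟨ cong (_∸ iverson (lookup X v)) (All.lookup (uniform G) X∈G) ⟩
    r ∸ iverson (lookup X v)                              ∎
    where open ≡-Reasoning
  uniform′ : All (λ Y → Subset.∣ Y ∣ ≡ r ∸ iverson b) (map (λ X → removeAt X v) (edgesWith v b (edges G)))
  uniform′ = All.map⁺ (All.tabulate size-removeAt)

link : RGraph r (suc n) → Fin (suc n) → RGraph (pred r) n
link G v = slice G v inside

removeVertex : RGraph r (suc n) → Fin (suc n) → RGraph r n
removeVertex G v = slice G v outside

size-slice : (G : RGraph r (suc n)) → ∀ v b → size (slice G v b) ≡ length (edgesWith v b (edges G))
size-slice G v b = length-map _ (edgesWith v b (edges G))

deg≤nC[pred[r]] : (G : RGraph r (suc n)) → ∀ v → deg v G ≤ n C pred r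
deg≤nC[pred[r]] G v = subst (_≤ _) (size-slice G v inside) (size≤nCr (link G v))

deg+size-removeVertex : (G : RGraph r (suc n)) → ∀ v → deg v G + size (removeVertex G v) ≡ size G
deg+size-removeVertex G v =
  trans (cong (_+_ (deg v G)) (size-slice G v outside)) (length-edgesWith-inside+outside v (edges G))

image-punchIn : ∀ (φ : Fin m → Fin n) v (e : Subset m) →
  image (punchIn v ∘ φ) e ≡ insertAt (image φ e) v outside
image-punchIn {m} {n} φ v e = trans (tabulate-cong pointwise) (tabulate∘lookup _)
  where
  hit? : ∀ {k} (ψ : Fin m → Fin k) j → Dec (∃ λ i → i Subset.∈ e × ψ i ≡ j)
  hit? ψ j = Fin.any? (λ i → (i ∈? e) ×-dec (ψ i Fin.≟ j))
  shifted : ∀ j → does (hit? (punchIn v ∘ φ) (punchIn v j)) ≡ lookup (insertAt (image φ e) v outside) (punchIn v j)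
  shifted j = begin
    does (hit? (punchIn v ∘ φ) (punchIn v j))
      ≡⟨ does-⇔ (mk⇔ (λ (i , i∈e , eq) → i , i∈e , Fin.punchIn-injective v _ _ eq)
                     (λ (i , i∈e , eq) → i , i∈e , cong (punchIn v) eq))
                 (hit? (punchIn v ∘ φ) (punchIn v j)) (hit? φ j) ⟩
    does (hit? φ j)                                      ≡⟨ lookup∘tabulate (does ∘ hit? φ) j ⟨
    lookup (image φ e) j                                 ≡⟨ insertAt-punchIn (image φ e) v outside j ⟨
    lookup (insertAt (image φ e) v outside) (punchIn v j) ∎
    where open ≡-Reasoning
  pointwise : ∀ j → does (hit? (punchIn v ∘ φ) j) ≡ lookup (insertAt (image φ e) v outside) j
  pointwise j with v Fin.≟ j
  ... | yes refl = trans (dec-false (hit? (punchIn v ∘ φ) v) (λ (i , _ , eq) → Fin.punchInᵢ≢i v (φ i) eq))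
                         (sym (insertAt-lookup (image φ e) v outside))
  ... | no v≢j  = subst (λ j → does (hit? (punchIn v ∘ φ) j) ≡ lookup (insertAt (image φ e) v outside) j)
                        (Fin.punchIn-punchOut v≢j) (shifted (punchOut v≢j))

FFree-removeVertex : ∀ (F : RGraph r m) (G : RGraph r (suc n)) v → FFree F G → FFree F (removeVertex G v)
FFree-removeVertex F G v G-free (φ , φ-injective , φ-edges) =
  G-free (punchIn v ∘ φ , φ-injective ∘ Fin.punchIn-injective v _ _ , All.map lift φ-edges)
  where
  lift : ∀ {e} → image φ e ∈ edges (removeVertex G v) → image (punchIn v ∘ φ) e ∈ edges G
  lift {e} e∈ with X , X∈G , eq , v∉X ← ∈-map∘filter⁻ (λ X → removeAt X v) (λ X → lookup X v Bool.≟ outside) e∈ =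
    subst (_∈ edges G) (sym (begin
      image (punchIn v ∘ φ) e                ≡⟨ image-punchIn φ v e ⟩
      insertAt (image φ e) v outside         ≡⟨ cong₂ (λ s b → insertAt s v b) eq (sym v∉X) ⟩
      insertAt (removeAt X v) v (lookup X v) ≡⟨ insertAt-removeAt X v ⟩
      X                                      ∎)) X∈G
    where open ≡-Reasoning

ex-deletion : ∀ (F : RGraph r m) {b} → IsEx F n b →
  (G : RGraph r (suc n)) → FFree F G → ∀ v → size G ≤ b + deg v G
ex-deletion F {b} (_ , extremal) G G-free v = begin
  size G                         ≡⟨ deg+size-removeVertex G v ⟨
  deg v G + size (removeVertex G v) ≤⟨ +-monoʳ-≤ (deg v G) (extremal (removeVertex G v) (FFree-removeVertex F G v G-free)) ⟩
  deg v G + b                    ≡⟨ +-comm (deg v G) b ⟩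
  b + deg v G                    ∎
  where open ≤-Reasoning

profile∈? : ∀ (P : Pattern) (part : Fin n → Fin (k P)) → Decidable (λ X → profile part X ∈ E P)
profile∈? P part X = DecMembership._∈?_ (≡-dec ℕ._≟_) (profile part X) (E P)

construction : ∀ r (P : Pattern) → (Fin n → Fin (k P)) → RGraph r n
construction {n} r P part = mkRGraph
  (filter (profile∈? P part) (subsetsOfSize n r))
  (Unique.filter⁺ (profile∈? P part) (subsetsOfSize-unique n r))
  (All.tabulate (∈-subsetsOfSize⁻ ∘ proj₁ ∘ ∈-filter⁻ (profile∈? P part)))

∈-construction⁺ : ∀ r (P : Pattern) (part : Fin n → Fin (k P)) {X} →
  Subset.∣ X ∣ ≡ r → profile part X ∈ E P → X ∈ edges (construction r P part)
∈-construction⁺ r P part {X} ∣X∣≡r X∈P = ∈-filter⁺ (profile∈? P part) (∈-subsetsOfSize⁺ X ∣X∣≡r) X∈P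

construction-isConstruction : ∀ r (P : Pattern) (part : Fin n → Fin (k P)) →
  IsConstruction P (construction r P part)
construction-isConstruction r P part = part , λ X → mk⇔
  (λ X∈ → let X∈subsets , X∈P = ∈-filter⁻ (profile∈? P part) X∈ in ∈-subsetsOfSize⁻ X∈subsets , X∈P)
  (λ (∣X∣≡r , X∈P) → ∈-construction⁺ r P part ∣X∣≡r X∈P)

clonePartition : ∀ {k} → (Fin n → Fin k) → Fin n → Fin (suc n) → Fin k
clonePartition part u zero    = part u
clonePartition part u (suc j) = part j

profile-clone : ∀ {k} (part : Fin n → Fin k) u (X : Subset n) → lookup X u ≡ inside →
  profile (clonePartition part u) (inside ∷ X [ u ]≔ outside) ≡ profile part X
profile-clone part u X u∈X = tabulate-cong λ i → begin
  Subset.∣ does (part u Fin.≟ i) ∷ (X [ u ]≔ outside) ∩ class i ∣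
    ≡⟨ ∣b∷p∣≡iverson[b]+∣p∣ (does (part u Fin.≟ i)) ((X [ u ]≔ outside) ∩ class i) ⟩
  iverson (does (part u Fin.≟ i)) + Subset.∣ (X [ u ]≔ outside) ∩ class i ∣
    ≡⟨ cong (λ b → iverson b + Subset.∣ (X [ u ]≔ outside) ∩ class i ∣) (lookup∘tabulate (λ j → does (part j Fin.≟ i)) u) ⟨
  iverson (lookup (class i) u) + Subset.∣ (X [ u ]≔ outside) ∩ class i ∣
    ≡⟨ ∣p∩q∣≡iverson[q[i]]+∣p[i]≔outside∩q∣ X (class i) u u∈X ⟨
  Subset.∣ X ∩ class i ∣ ∎
  where
  open ≡-Reasoning
  class : ∀ i → Subset _
  class i = tabulate (λ j → does (part j Fin.≟ i))

cloneEdges : Fin n → List (Subset n) → List (Subset (suc n))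
cloneEdges u L = map (outside ∷_) L ++ map (λ X → inside ∷ X [ u ]≔ outside) (edgesWith u inside L)

length-cloneEdges : ∀ u (L : List (Subset n)) → length (cloneEdges u L) ≡ length L + length (edgesWith u inside L)
length-cloneEdges u L =
  trans (length-++ (map (outside ∷_) L)) (cong₂ _+_ (length-map _ L) (length-map _ (edgesWith u inside L)))

cloneEdges-unique : ∀ u {L : List (Subset n)} → Unique L → Unique (cloneEdges u L)
cloneEdges-unique u {L} !L = Unique.++⁺
  (Unique.map⁺ ∷-injectiveʳ !L)
  (Unique-map⁺ (λ X∈ Y∈ eq → []≔outside-injectiveOn _ _ u (through X∈) (through Y∈) (∷-injectiveʳ eq))
               (Unique.filter⁺ _ !L))
  heads-differ
  where
  through : ∀ {X} → X ∈ edgesWith u inside L → lookup X u ≡ inside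
  through X∈ = proj₂ (∈-filter⁻ (λ X → lookup X u Bool.≟ inside) {xs = L} X∈)
  heads-differ : ∀ {Y} → Y ∈ map (outside ∷_) L × Y ∈ map (λ X → inside ∷ X [ u ]≔ outside) (edgesWith u inside L) → ⊥
  heads-differ (Y∈₁ , Y∈₂) with ∈-map⁻ (outside ∷_) Y∈₁ | ∈-map⁻ (λ X → inside ∷ X [ u ]≔ outside) Y∈₂
  ... | _ , _ , refl | _ , _ , ()

cloneEdges⊆construction : ∀ {P} (G : RGraph r n) ((part , isC) : IsConstruction P G) u →
  cloneEdges u (edges G) ⊆ edges (construction r P (clonePartition part u))
cloneEdges⊆construction {r} {P = P} G (part , isC) u Y∈ with ∈-++⁻ (map (outside ∷_) (edges G)) Y∈
... | inj₁ Y∈₁ with X , X∈G , refl ← ∈-map⁻ (outside ∷_) Y∈₁ =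
  let ∣X∣≡r , X∈P = Equivalence.to (isC X) X∈G in ∈-construction⁺ r P (clonePartition part u) ∣X∣≡r X∈P
... | inj₂ Y∈₂ with X , X∈ , refl ← ∈-map⁻ (λ X → inside ∷ X [ u ]≔ outside) Y∈₂ =
  let X∈G , u∈X = ∈-filter⁻ (λ X → lookup X u Bool.≟ inside) X∈
      ∣X∣≡r , X∈P = Equivalence.to (isC X) X∈G in
  ∈-construction⁺ r P (clonePartition part u)
    (trans (∣inside∷p[i]≔outside∣≡∣p∣ X u u∈X) ∣X∣≡r)
    (subst (_∈ E P) (sym (profile-clone part u X u∈X)) X∈P)

ex-cloning : ∀ (F : RGraph r m) P {a} → TuranPair F P → IsEx F (suc n) a →
  (G : RGraph r n) → FFree F G → (∀ H → FFree F H → size H ≤ size G) → ∀ u → size G + deg u G ≤ a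
ex-cloning {r} {n = n} F P {a} (constructions-free , extremal-constructions) (_ , extremal) G G-free G-max u = begin
  size G + deg u G                ≡⟨ length-cloneEdges u (edges G) ⟨
  length (cloneEdges u (edges G)) ≤⟨ unique-⊆⇒length≤ (cloneEdges-unique u (unique G)) (cloneEdges⊆construction G con u) ⟩
  size clone                      ≤⟨ extremal clone (constructions-free (suc n) clone (construction-isConstruction r P (clonePartition (proj₁ con) u))) ⟩
  a                               ∎
  where
  open ≤-Reasoning
  con : IsConstruction P G
  con = extremal-constructions n G G-free G-max
  clone : RGraph r (suc n)
  clone = construction r P (clonePartition (proj₁ con) u)

m+n≤o*m⇒n≤pred[o]*m : ∀ o {m k} → m + k ≤ o * m → k ≤ pred o * m
m+n≤o*m⇒n≤pred[o]*m zero    {m} m+k≤0 = m+n≤o⇒n≤o m m+k≤0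
m+n≤o*m⇒n≤pred[o]*m (suc o) {m} m+k≤m+o*m = +-cancelˡ-≤ m _ _ m+k≤m+o*m

excess-bound : ∀ N r b x →
  suc N * (b + x) ≤ suc N * b + r * (b + x) → r * b ≤ N * x → x ≤ N C pred r →
  N * x ∸ r * b ≤ N * binomMinus2 N r
excess-bound N r b x deleting rb≤Nx x≤C = begin
  N * x ∸ r * b         ≤⟨ m+n≤o*m⇒n≤pred[o]*m r x+excess≤r*x ⟩
  pred r * x            ≤⟨ *-monoʳ-≤ (pred r) x≤C ⟩
  pred r * (N C pred r) ≤⟨ pred[r]*nC[pred[r]]≤n*binomMinus2 N r ⟩
  N * binomMinus2 N r   ∎
  where
  open ≤-Reasoning
  expand : ∀ N b x → suc N * (b + x) ≡ suc N * b + (x + N * x)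
  expand = solve-∀
  x+excess≤r*x : x + (N * x ∸ r * b) ≤ r * x
  x+excess≤r*x = +-cancelʳ-≤ (r * b) _ _ (begin
    x + (N * x ∸ r * b) + r * b ≡⟨ +-assoc x (N * x ∸ r * b) (r * b) ⟩
    x + (N * x ∸ r * b + r * b) ≡⟨ cong (_+_ x) (m∸n+n≡m rb≤Nx) ⟩
    x + N * x                   ≤⟨ +-cancelˡ-≤ (suc N * b) _ _
                                     (subst₂ _≤_ (expand N b x) (cong (_+_ (suc N * b)) (*-distribˡ-+ r b x)) deleting) ⟩
    r * b + r * x               ≡⟨ +-comm (r * b) (r * x) ⟩
    r * x + r * b               ∎)

∣N*[[b+x]-b]-r*b∣≡N*x∸r*b : ∀ N r b x → r * b ≤ N * x →
  ∣ + N ℤ.* (+ (b + x) - + b) - + r ℤ.* + b ∣ ≡ N * x ∸ r * b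
∣N*[[b+x]-b]-r*b∣≡N*x∸r*b N r b x rb≤Nx = cong ∣_∣ (begin
  + N ℤ.* (+ (b + x) - + b) - + r ℤ.* + b ≡⟨ cong (λ d → + N ℤ.* d - + r ℤ.* + b) [b+x]-b≡x ⟩
  + N ℤ.* + x - + r ℤ.* + b               ≡⟨ cong₂ _-_ (ℤP.pos-* N x) (ℤP.pos-* r b) ⟨
  + (N * x) - + (r * b)                   ≡⟨ ℤP.[+m]-[+n]≡m⊖n (N * x) (r * b) ⟩
  N * x ℤ.⊖ r * b                         ≡⟨ ℤP.⊖-≥ rb≤Nx ⟩
  + (N * x ∸ r * b)                       ∎)
  where
  open ≡-Reasoning
  [b+x]-b≡x : + (b + x) - + b ≡ + x
  [b+x]-b≡x = trans (ℤP.[+m]-[+n]≡m⊖n (b + x) b) (trans (ℤP.⊖-≥ (m≤m+n b x)) (cong +_ (m+n∸m≡n b x)))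

bound-from-averages : ∀ N .{{_ : NonZero N}} r a b →
  suc N * a ≤ suc N * b + r * a → N * b + r * b ≤ N * a → a ≤ b + N C pred r →
  ∣ + N ℤ.* (+ a - + b) - + r ℤ.* + b ∣ ≤ N * binomMinus2 N r
bound-from-averages N r a b deleting cloning degree
  with x , refl ← m≤n⇒∃[o]m+o≡n (*-cancelˡ-≤ N (≤-trans (m≤m+n (N * b) (r * b)) cloning)) = begin
    ∣ + N ℤ.* (+ (b + x) - + b) - + r ℤ.* + b ∣ ≡⟨ ∣N*[[b+x]-b]-r*b∣≡N*x∸r*b N r b x rb≤Nx ⟩
    N * x ∸ r * b                               ≤⟨ excess-bound N r b x deleting rb≤Nx (+-cancelˡ-≤ b _ _ degree) ⟩
    N * binomMinus2 N r                         ∎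
  where
  open ≤-Reasoning
  rb≤Nx : r * b ≤ N * x
  rb≤Nx = +-cancelˡ-≤ (N * b) _ _ (subst (N * b + r * b ≤_) (*-distribˡ-+ N b x) cloning)

smoothness : ∀ (F : RGraph r m) P → TuranPair F P → ∀ N .{{_ : NonZero N}} {a b} →
  IsEx F (suc N) a → IsEx F N b → ∣ + N ℤ.* (+ a - + b) - + r ℤ.* + b ∣ ≤ N * binomMinus2 N r
smoothness {r} F P turan N exA@((G , G-free , refl) , _) exB@((G′ , G′-free , refl) , G′-max) =
  bound-from-averages N r (size G) (size G′) deleting cloning degree
  where
  open ≤-Reasoning
  deleting : suc N * size G ≤ suc N * size G′ + r * size G
  deleting = begin
    suc N * size G                     ≡⟨ ∑-const (suc N) (size G) ⟨
    ∑[ v < suc N ] size G              ≤⟨ ∑-mono-≤ (ex-deletion F exB G G-free) ⟩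
    ∑[ v < suc N ] (size G′ + deg v G) ≡⟨ ∑[d+deg]≡n*d+r*size (size G′) G ⟩
    suc N * size G′ + r * size G       ∎
  cloning : N * size G′ + r * size G′ ≤ N * size G
  cloning = begin
    N * size G′ + r * size G′        ≡⟨ ∑[d+deg]≡n*d+r*size (size G′) G′ ⟨
    ∑[ u < N ] (size G′ + deg u G′)  ≤⟨ ∑-mono-≤ (ex-cloning F P turan exA G′ G′-free G′-max) ⟩
    ∑[ u < N ] size G                ≡⟨ ∑-const N (size G) ⟩
    N * size G                       ∎
  degree : size G ≤ size G′ + N C pred r
  degree = ≤-trans (ex-deletion F exB G G-free zero) (+-monoʳ-≤ (size G′) (deg≤nC[pred[r]] G zero))

theorem1p9 : ∀ {r m : ℕ} (F : RGraph r m) (P : Pattern) →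
    IsRPattern r P → Minimal r P → TuranPair F P →
    ∀ (n a b : ℕ) → 2 ≤ n → IsEx F n a → IsEx F (n ∸ 1) b →
    ∣ (+ (n ∸ 1)) ℤ.* ((+ a) - (+ b)) - (+ r) ℤ.* (+ b) ∣ ≤ 4 * (n ∸ 1) * binomMinus2 (n ∸ 1) r
theorem1p9 F P _ _ _ (suc zero) a b (s≤s ()) exA exB
theorem1p9 {r} F P _ _ turan (suc (suc M)) a b _ exA exB =
  ≤-trans (smoothness F P turan (suc M) exA exB) (*-monoˡ-≤ (binomMinus2 (suc M) r) (m≤n*m (suc M) 4))
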